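{- For every formula $f \in \mathrm{QSL}[\mathfrak{A}]$, the semantics $[\![ f ]\!]$ is well-defined, i.e., every maximum and minimum occurring in its defining clauses exists (is attained), and $[\![ f ]\!]$ is a one-bounded expectation: $[\![ f ]\!](s,h) \in [0,1]$ for all states $(s,h)$.
   Context: Fix a record size $k \ge 1$, a set $\mathrm{Vars}$ of variables, a set $\mathrm{Vals}$ of values and a set $\mathrm{Locs}\subseteq \mathrm{Vals}$ of locations. A stack is a map $s\colon \mathrm{Vars}\to\mathrm{Vals}$; a heap is a finite partial map $h\colon \mathrm{Locs}\rightharpoonup \mathrm{Vals}^k$; $\mathrm{States}$ is the set of pairs $(s,h)$. Heaps $h_1,h_2$ are disjoint ($h_1\perp h_2$) if their domains are disjoint, and $h_1\star h_2$ is then their union; $s[x\mapsto v]$ is the updated stack. A predicate is a subset of $\mathrm{States}$; $\mathfrak{A}$ is a set of predicates. $\mathbb{P}=\mathbb{Q}\cap[0,1]$. $\mathrm{SL}[\mathfrak{A}]$ formulae: $\varphi ::= \mathsf{true} \mid a\ (a\in\mathfrak{A}) \mid \neg\varphi \mid \varphi\wedge\varphi\mid\varphi\vee\varphi\mid \exists x\colon\varphi\mid\forall x\colon\varphi\mid \varphi\star\varphi\mid \varphi \mathbin{ -\!\!\star}\varphi$, with the standard separation logic semantics ($(s,h)\models a$ iff $(s,h)\in a$; quantifiers range over $\mathrm{Vals}$; $\varphi_1\star\varphi_2$ holds iff $h=h_1\star h_2$ with $(s,h_1)\models\varphi_1$, $(s,h_2)\models\varphi_2$; $\varphi_1\mathbin{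 -\!\!\star}\varphi_2$ holds iff for all $h'\perp h$ with $(s,h')\models\varphi_1$, $(s,h\star h')\models\varphi_2$). A formula is pure if its truth does not depend on the heap. $\mathrm{QSL}[\mathfrak{A}]$ formulae: $f ::= [\varphi] \mid [b]\cdot f + [\neg b]\cdot f \mid q\cdot f+(1-q)\cdot f \mid f\cdot f\mid 1-f\mid \max(f,f)\mid\min(f,f)\mid \mathsf{S}x\colon f\mid \mathsf{J}x\colon f\mid f\star f\mid [\varphi]\mathbin{ -\!\!\star} f$, where $\varphi\in\mathrm{SL}[\mathfrak{A}]$, $b\in \mathrm{SL}[\mathfrak{A}]$ is pure, and $q\in\mathbb{P}$. Semantics $[\![f]\!]\colon\mathrm{States}\to\mathbb{R}$: $[\![[\varphi]]\!](s,h)=1$ if $(s,h)\models\varphi$ and $0$ otherwise; the arithmetic operators, $\max$ and $\min$ are pointwise; $[\![\mathsf{S}x\colon g]\!](s,h)=\max\{[\![g]\!](s[x\mapsto v],h)\mid v\in\mathrm{Vals}\}$; $[\![\mathsf{J}x\colon g]\!](s,h)=\min\{[\![g]\!](s[x\mapsto v],h)\mid v\in\mathrm{Vals}\}$; $[\![g\star u]\!](s,h)=\max\{[\![g]\!](s,h_1)\cdot[\![u]\!](s,h_2)\mid h=h_1\star h_2\}$; $[\![[\varphi]\mathbin{ -\!\!\star} g]\!](s,h)=\inf\{[\![g]\!](s,h\star h')\mid h'\perp h,\ (s,h')\models\varphi\}$ (infimum taken in $[0,1]$). -}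

module Defs where

open import Data.Nat using (ℕ)
open import Data.Vec using (Vec)
open import Data.List using (List)
open import Data.List.Membership.Propositional using (_∈_)
open import Data.Maybe using (Maybe; nothing)
open import Data.Product using (Σ; ∃; _×_; _,_)
open import Data.Sum using (_⊎_)
open import Data.Rational using (ℚ; 0ℚ; 1ℚ; _≤_; _+_; _*_; _-_)
open import Relation.Nullary using (¬_)
open import Relation.Binary.PropositionalEquality using (_≡_; _≢_)
open import Function.Definitions using (Injective)

-- Excluded middle (the paper reasons classically).
LEM : Set₁
LEM = (P : Set) → P ⊎ ¬ P

IsMax : (ℚ → Set) → ℚ → Set
IsMax S r = S r × (∀ t → S t → t ≤ r)

IsMin : (ℚ → Set) → ℚ → Set
IsMin S r = S r × (∀ t → S t → r ≤ t)

-- infimum taken in [0,1] (so the infimum of the empty set is 1)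
IsInf01 : (ℚ → Set) → ℚ → Set
IsInf01 S r = (0ℚ ≤ r × r ≤ 1ℚ)
            × (∀ t → S t → r ≤ t)
            × (∀ r' → 0ℚ ≤ r' → r' ≤ 1ℚ → (∀ t → S t → r' ≤ t) → r' ≤ r)

-- The state model: record size k, variables Var, values Val,
-- locations Loc ⊆ Val (embedded via the injection ι).
module Model (k : ℕ) (Var Val Loc : Set) (ι : Loc → Val) (ι-inj : Injective _≡_ _≡_ ι) where

  Stack : Set
  Stack = Var → Val

  Upd : Stack → Var → Val → Stack → Set
  Upd s x v s' = (s' x ≡ v) × (∀ y → y ≢ x → s' y ≡ s y)

  record Heap : Set where
    field
      fun : Loc → Maybe (Vec Val k)
      dom : List Loc
      finite : ∀ l → fun l ≢ nothing → l ∈ dom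
  open Heap public

  Disjoint : Heap → Heap → Set
  Disjoint h₁ h₂ = ∀ l → (fun h₁ l ≡ nothing) ⊎ (fun h₂ l ≡ nothing)

  -- h ≡ h₁ ⋆ h₂ (h₁, h₂ disjoint and h their union)
  Union : Heap → Heap → Heap → Set
  Union h h₁ h₂ = ∀ l → ((fun h l ≡ fun h₁ l) × (fun h₂ l ≡ nothing))
                      ⊎ ((fun h l ≡ fun h₂ l) × (fun h₁ l ≡ nothing))

  -- 𝔄 is given as an index type Atom with its interpretation as predicates on states
  module Logic (Atom : Set) (⟦_⟧ₐ : Atom → Stack → Heap → Set) where

    data SL : Set where
      true : SL
      atom : Atom → SL
      ¬' : SL → SL
      _∧'_ _∨'_ : SL → SL → SL
      ∃' ∀' : Var → SL → SL
      _⋆'_ _-⋆'_ : SL → SL → SL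

    _⊨_ : Stack × Heap → SL → Set
    (s , h) ⊨ true = ⊤' where open import Data.Unit using () renaming (⊤ to ⊤')
    (s , h) ⊨ atom a = ⟦ a ⟧ₐ s h
    (s , h) ⊨ ¬' φ = ¬ ((s , h) ⊨ φ)
    (s , h) ⊨ (φ ∧' ψ) = ((s , h) ⊨ φ) × ((s , h) ⊨ ψ)
    (s , h) ⊨ (φ ∨' ψ) = ((s , h) ⊨ φ) ⊎ ((s , h) ⊨ ψ)
    (s , h) ⊨ ∃' x φ = Σ Val λ v → Σ Stack λ s' → Upd s x v s' × ((s' , h) ⊨ φ)
    (s , h) ⊨ ∀' x φ = (v : Val) (s' : Stack) → Upd s x v s' → (s' , h) ⊨ φ
    (s , h) ⊨ (φ ⋆' ψ) = Σ Heap λ h₁ → Σ Heap λ h₂ → Union h h₁ h₂ × ((s , h₁) ⊨ φ) × ((s , h₂) ⊨ ψ)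
    (s , h) ⊨ (φ -⋆' ψ) = (h' : Heap) → Disjoint h h' → (s , h') ⊨ φ →
                           (h'' : Heap) → Union h'' h h' → (s , h'') ⊨ ψ

    Pure : SL → Set
    Pure b = ∀ s h h' → (s , h) ⊨ b → (s , h') ⊨ b

    data QSL : Set where
      [_] : SL → QSL
      guard : (b : SL) → Pure b → QSL → QSL → QSL          -- [b]·f + [¬b]·g
      conv : (q : ℚ) → 0ℚ ≤ q → q ≤ 1ℚ → QSL → QSL → QSL    -- q·f + (1-q)·g
      _·_ : QSL → QSL → QSL
      1-_ : QSL → QSL
      max' min' : QSL → QSL → QSL
      S J : Var → QSL → QSL
      _⋆_ : QSL → QSL → QSL
      _-⋆_ : SL → QSL → QSL                                 -- [φ] -⋆ f

    -- Relational semantics: ⟦ f ⟧ s h r  means  [[f]](s,h) = r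
    -- (every max/min is required to be attained).
    Ind : SL → Stack → Heap → ℚ → Set
    Ind φ s h r = (((s , h) ⊨ φ) × r ≡ 1ℚ) ⊎ ((¬ ((s , h) ⊨ φ)) × r ≡ 0ℚ)

    ⟦_⟧ : QSL → Stack → Heap → ℚ → Set
    ⟦ [ φ ] ⟧ s h r = Ind φ s h r
    ⟦ guard b _ f g ⟧ s h r = Σ ℚ λ β → Σ ℚ λ β' → Σ ℚ λ a → Σ ℚ λ c →
        Ind b s h β × Ind (¬' b) s h β' × ⟦ f ⟧ s h a × ⟦ g ⟧ s h c × (r ≡ β * a + β' * c)
    ⟦ conv q _ _ f g ⟧ s h r = Σ ℚ λ a → Σ ℚ λ c →
        ⟦ f ⟧ s h a × ⟦ g ⟧ s h c × (r ≡ q * a + (1ℚ - q) * c)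
    ⟦ f · g ⟧ s h r = Σ ℚ λ a → Σ ℚ λ c → ⟦ f ⟧ s h a × ⟦ g ⟧ s h c × (r ≡ a * c)
    ⟦ 1- f ⟧ s h r = Σ ℚ λ a → ⟦ f ⟧ s h a × (r ≡ 1ℚ - a)
    ⟦ max' f g ⟧ s h r = IsMax (λ t → ⟦ f ⟧ s h t ⊎ ⟦ g ⟧ s h t) r
    ⟦ min' f g ⟧ s h r = IsMin (λ t → ⟦ f ⟧ s h t ⊎ ⟦ g ⟧ s h t) r
    ⟦ S x g ⟧ s h r = IsMax (λ t → Σ Val λ v → Σ Stack λ s' → Upd s x v s' × ⟦ g ⟧ s' h t) r
    ⟦ J x g ⟧ s h r = IsMin (λ t → Σ Val λ v → Σ Stack λ s' → Upd s x v s' × ⟦ g ⟧ s' h t) r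
    ⟦ g ⋆ u ⟧ s h r = IsMax (λ t → Σ Heap λ h₁ → Σ Heap λ h₂ → Union h h₁ h₂ ×
        (Σ ℚ λ a → Σ ℚ λ c → ⟦ g ⟧ s h₁ a × ⟦ u ⟧ s h₂ c × (t ≡ a * c))) r
    ⟦ φ -⋆ g ⟧ s h r = IsInf01 (λ t → Σ Heap λ h' → Σ Heap λ h'' →
        Disjoint h h' × ((s , h') ⊨ φ) × Union h'' h h' × ⟦ g ⟧ s h'' t) r

{-# OPTIONS --safe #-}
module Submission where

-- Every formula takes its values in a finite set of rationals determined by its syntax alone
-- (the closure of {0, 1} under the arithmetic of the formula's constructors).  A set of
-- rationals contained in a finite list has, classically, a greatest and a least element
-- whenever it is inhabited, so every max, min and infimum of the semantics is attained;
-- the bounds are the closure of [0,1] under products, 1 - _ and convex combinations.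

open import Defs
open import Data.Nat using (ℕ; _≤_)
open import Data.Product using (Σ; _×_; _,_; proj₁; proj₂; ∃)
open import Data.Rational using (ℚ; 0ℚ; 1ℚ; _+_; _*_; _-_; -_; nonNegative) renaming (_≤_ to _≤ℚ_)
import Data.Rational.Properties as ℚ
open import Data.Rational.Solver using (module +-*-Solver)
open import Data.Sum using (_⊎_; inj₁; inj₂; [_,_]; map₂)
open import Data.Empty using (⊥-elim)
open import Data.Maybe using (nothing)
open import Data.List using (List; []; _∷_; _++_; map; cartesianProductWith)
open import Data.List.Relation.Unary.Any using (here; there; toSum)
open import Data.List.Relation.Unary.Any.Properties using (¬Any[])
open import Data.List.Membership.Propositional using (_∈_)
open import Data.List.Membership.Propositional.Properties
  using (∈-map⁺; ∈-++⁺ˡ; ∈-++⁺ʳ; ∈-cartesianProductWith⁺)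
open import Level using (0ℓ)
open import Relation.Binary.Bundles using (TotalPreorder)
import Relation.Binary.Construct.Flip.EqAndOrd as Flip
open import Relation.Nullary using (¬_)
open import Relation.Binary.PropositionalEquality
  using (_≡_; refl; sym; cong; cong₂; subst)
open import Function.Definitions using (Injective)

module FiniteExtremum {ℓ₁ ℓ₂} (O : TotalPreorder 0ℓ ℓ₁ ℓ₂) where
  open TotalPreorder O renaming (Carrier to A; refl to ≲-refl; trans to ≲-trans)

  Greatest : (A → Set) → A → Set _
  Greatest P r = P r × (∀ t → P t → t ≲ r)

  empty⊎greatest : LEM → (L : List A) (P : A → Set) → (∀ {t} → P t → t ∈ L) →
                   (∀ t → ¬ P t) ⊎ ∃ (Greatest P)
  empty⊎greatest lem [] P P⊆L = inj₁ λ t Pt → ¬Any[] (P⊆L Pt)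
  empty⊎greatest lem (x ∷ xs) P P⊆L with lem (P x)
  ... | inj₂ ¬Px = empty⊎greatest lem xs P P⊆xs
    where
      P⊆xs : ∀ {t} → P t → t ∈ xs
      P⊆xs Pt with toSum (P⊆L Pt)
      ... | inj₁ refl = ⊥-elim (¬Px Pt)
      ... | inj₂ t∈xs = t∈xs
  ... | inj₁ Px = inj₂ (greatest (empty⊎greatest lem xs (λ t → P t × t ∈ xs) proj₂))
    where
      x-or-tail : ∀ {t} → P t → t ≡ x ⊎ (P t × t ∈ xs)
      x-or-tail Pt = map₂ (Pt ,_) (toSum (P⊆L Pt))

      greatest : (∀ t → ¬ (P t × t ∈ xs)) ⊎ ∃ (Greatest (λ t → P t × t ∈ xs)) → ∃ (Greatest P)
      greatest (inj₁ none) = x , Px , λ t Pt →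
        [ (λ { refl → ≲-refl }) , (λ Qt → ⊥-elim (none t Qt)) ] (x-or-tail Pt)
      greatest (inj₂ (m , (Pm , _) , m-max)) with total x m
      ... | inj₁ x≲m = m , Pm , λ t Pt → [ (λ { refl → x≲m }) , m-max t ] (x-or-tail Pt)
      ... | inj₂ m≲x = x , Px , λ t Pt →
        [ (λ { refl → ≲-refl }) , (λ Qt → ≲-trans (m-max t Qt) m≲x) ] (x-or-tail Pt)

module Max = FiniteExtremum ℚ.≤-totalPreorder
module Min = FiniteExtremum (Flip.totalPreorder ℚ.≤-totalPreorder)

_∈[0,1] : ℚ → Set
r ∈[0,1] = 0ℚ ≤ℚ r × r ≤ℚ 1ℚ

0≤1 : 0ℚ ≤ℚ 1ℚ
0≤1 = ℚ.≤ᵇ⇒≤ _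

*-∈[0,1] : ∀ {a c} → a ∈[0,1] → c ∈[0,1] → (a * c) ∈[0,1]
*-∈[0,1] {a} {c} (0≤a , a≤1) (0≤c , c≤1) =
  ℚ.nonNegative⁻¹ (a * c) {{ℚ.nonNeg*nonNeg⇒nonNeg a {{nonNegative 0≤a}} c {{nonNegative 0≤c}}}} ,
  (begin
    a * c   ≤⟨ ℚ.*-monoʳ-≤-nonNeg c {{nonNegative 0≤c}} a≤1 ⟩
    1ℚ * c  ≡⟨ ℚ.*-identityˡ c ⟩
    c       ≤⟨ c≤1 ⟩
    1ℚ      ∎)
  where open ℚ.≤-Reasoning

1-‿∈[0,1] : ∀ {a} → a ∈[0,1] → (1ℚ - a) ∈[0,1]
1-‿∈[0,1] {a} (0≤a , a≤1) =
  subst (_≤ℚ 1ℚ - a) (ℚ.+-inverseʳ a) (ℚ.+-monoˡ-≤ (- a) a≤1) ,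
  subst (1ℚ - a ≤ℚ_) (ℚ.+-identityʳ 1ℚ) (ℚ.+-monoʳ-≤ 1ℚ (ℚ.neg-antimono-≤ 0≤a))

convex-∈[0,1] : ∀ {q a c} → q ∈[0,1] → a ∈[0,1] → c ∈[0,1] → (q * a + (1ℚ - q) * c) ∈[0,1]
convex-∈[0,1] {q} {a} {c} q∈ a∈ c∈ =
  ℚ.+-mono-≤ {0ℚ} {_} {0ℚ} (proj₁ (*-∈[0,1] q∈ a∈)) (proj₁ (*-∈[0,1] 1-q∈ c∈)) ,
  (begin
    q * a + (1ℚ - q) * c    ≤⟨ ℚ.+-mono-≤ (scale q (proj₁ q∈) (proj₂ a∈))
                                          (scale (1ℚ - q) (proj₁ 1-q∈) (proj₂ c∈)) ⟩
    q * 1ℚ + (1ℚ - q) * 1ℚ  ≡⟨ solve 1 (λ q → q :* con 1ℚ :+ (con 1ℚ :- q) :* con 1ℚ := con 1ℚ)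
                                       refl q ⟩
    1ℚ                      ∎)
  where
    open ℚ.≤-Reasoning
    open +-*-Solver
    1-q∈ = 1-‿∈[0,1] q∈
    scale : ∀ p {x} → 0ℚ ≤ℚ p → x ≤ℚ 1ℚ → p * x ≤ℚ p * 1ℚ
    scale p 0≤p = ℚ.*-monoˡ-≤-nonNeg p {{nonNegative 0≤p}}

module _ {S : ℚ → Set} where

  isMax-unique : ∀ {r r'} → IsMax S r → IsMax S r' → r ≡ r'
  isMax-unique (Sr , r-max) (Sr' , r'-max) = ℚ.≤-antisym (r'-max _ Sr) (r-max _ Sr')

  isMin-unique : ∀ {r r'} → IsMin S r → IsMin S r' → r ≡ r'
  isMin-unique (Sr , r-min) (Sr' , r'-min) = ℚ.≤-antisym (r-min _ Sr') (r'-min _ Sr)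

  isInf01-unique : ∀ {r r'} → IsInf01 S r → IsInf01 S r' → r ≡ r'
  isInf01-unique ((0≤r , r≤1) , r-lb , r-glb) ((0≤r' , r'≤1) , r'-lb , r'-glb) =
    ℚ.≤-antisym (r'-glb _ 0≤r r≤1 r-lb) (r-glb _ 0≤r' r'≤1 r'-lb)

  finite-isMax : LEM → ∀ L → (∀ {t} → S t → t ∈ L) → ∀ {t} → S t → ∃ (IsMax S)
  finite-isMax lem L S⊆L St with Max.empty⊎greatest lem L S S⊆L
  ... | inj₁ none = ⊥-elim (none _ St)
  ... | inj₂ max = max

  finite-isMin : LEM → ∀ L → (∀ {t} → S t → t ∈ L) → ∀ {t} → S t → ∃ (IsMin S)
  finite-isMin lem L S⊆L St with Min.empty⊎greatest lem L S S⊆L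
  ... | inj₁ none = ⊥-elim (none _ St)
  ... | inj₂ min = min

  -- The infimum in [0,1] is 1 for the empty set and the least element otherwise.
  finite-isInf01 : LEM → ∀ L → (∀ {t} → S t → t ∈ L) → (∀ {t} → S t → t ∈[0,1]) →
                   ∃ λ r → r ∈ 1ℚ ∷ L × IsInf01 S r
  finite-isInf01 lem L S⊆L S⊆[0,1] with Min.empty⊎greatest lem L S S⊆L
  ... | inj₁ none =
    1ℚ , here refl , (0≤1 , ℚ.≤-refl) , (λ t St → ⊥-elim (none t St)) , λ _ _ r'≤1 _ → r'≤1
  ... | inj₂ (m , Sm , m-min) = m , there (S⊆L Sm) , S⊆[0,1] Sm , m-min , λ _ _ _ r'-lb → r'-lb m Sm

module Semantics (k : ℕ) (Var Val Loc : Set) (ι : Loc → Val) (ι-inj : Injective _≡_ _≡_ ι)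
    (Atom : Set) (interp : Atom → Model.Stack k Var Val Loc ι ι-inj → Model.Heap k Var Val Loc ι ι-inj → Set)
    (lem : LEM) where
  open Model k Var Val Loc ι ι-inj
  open Logic Atom interp

  ∅ : Heap
  ∅ = record { fun = λ _ → nothing ; dom = [] ; finite = λ _ ≢nothing → ⊥-elim (≢nothing refl) }

  h≡h⋆∅ : ∀ h → Union h h ∅
  h≡h⋆∅ h l = inj₁ (refl , refl)

  upd-self : ∀ s x → Upd s x (s x) s
  upd-self s x = refl , λ _ _ → refl

  ind-total : ∀ φ s h → ∃ (Ind φ s h)
  ind-total φ s h with lem ((s , h) ⊨ φ)
  ... | inj₁ sat = 1ℚ , inj₁ (sat , refl)
  ... | inj₂ unsat = 0ℚ , inj₂ (unsat , refl)

  module _ (φ : SL) {s : Stack} {h : Heap} where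

    ind-functional : ∀ {r r'} → Ind φ s h r → Ind φ s h r' → r ≡ r'
    ind-functional (inj₁ (_ , refl)) (inj₁ (_ , refl)) = refl
    ind-functional (inj₁ (sat , _)) (inj₂ (unsat , _)) = ⊥-elim (unsat sat)
    ind-functional (inj₂ (unsat , _)) (inj₁ (sat , _)) = ⊥-elim (unsat sat)
    ind-functional (inj₂ (_ , refl)) (inj₂ (_ , refl)) = refl

    ind-∈-01 : ∀ {r} → Ind φ s h r → r ∈ 0ℚ ∷ 1ℚ ∷ []
    ind-∈-01 (inj₁ (_ , refl)) = there (here refl)
    ind-∈-01 (inj₂ (_ , refl)) = here refl

    ind-∈[0,1] : ∀ {r} → Ind φ s h r → r ∈[0,1]
    ind-∈[0,1] (inj₁ (_ , refl)) = 0≤1 , ℚ.≤-refl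
    ind-∈[0,1] (inj₂ (_ , refl)) = ℚ.≤-refl , 0≤1

    ind-¬ : ∀ {β β'} → Ind φ s h β → Ind (¬' φ) s h β' → β' ≡ 1ℚ - β
    ind-¬ (inj₁ (sat , _)) (inj₁ (unsat , _)) = ⊥-elim (unsat sat)
    ind-¬ (inj₁ (_ , refl)) (inj₂ (_ , refl)) = refl
    ind-¬ (inj₂ (_ , refl)) (inj₁ (_ , refl)) = refl
    ind-¬ (inj₂ (unsat , _)) (inj₂ (¬unsat , _)) = ⊥-elim (¬unsat unsat)

  values : QSL → List ℚ
  values [ φ ] = 0ℚ ∷ 1ℚ ∷ []
  values (guard b _ f g) =
    cartesianProductWith _+_ (cartesianProductWith _*_ (values [ b ]) (values f))
                             (cartesianProductWith _*_ (values [ b ]) (values g))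
  values (conv q _ _ f g) = cartesianProductWith _+_ (map (q *_) (values f)) (map ((1ℚ - q) *_) (values g))
  values (f · g) = cartesianProductWith _*_ (values f) (values g)
  values (1- f) = map (λ a → 1ℚ - a) (values f)
  values (max' f g) = values f ++ values g
  values (min' f g) = values f ++ values g
  values (S x g) = values g
  values (J x g) = values g
  values (g ⋆ u) = cartesianProductWith _*_ (values g) (values u)
  values (φ -⋆ g) = 1ℚ ∷ values g

  ⟦⟧-∈[0,1] : ∀ f {s h r} → ⟦ f ⟧ s h r → r ∈[0,1]
  ⟦⟧-∈[0,1] [ φ ] ind = ind-∈[0,1] φ ind
  -- [¬ b] = 1 - [b], so a guarded choice is a convex combination.
  ⟦⟧-∈[0,1] (guard b _ f g) (_ , _ , _ , _ , β , β' , fa , gc , refl)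
    rewrite ind-¬ b β β' = convex-∈[0,1] (ind-∈[0,1] b β) (⟦⟧-∈[0,1] f fa) (⟦⟧-∈[0,1] g gc)
  ⟦⟧-∈[0,1] (conv q 0≤q q≤1 f g) (_ , _ , fa , gc , refl) =
    convex-∈[0,1] (0≤q , q≤1) (⟦⟧-∈[0,1] f fa) (⟦⟧-∈[0,1] g gc)
  ⟦⟧-∈[0,1] (f · g) (_ , _ , fa , gc , refl) = *-∈[0,1] (⟦⟧-∈[0,1] f fa) (⟦⟧-∈[0,1] g gc)
  ⟦⟧-∈[0,1] (1- f) (_ , fa , refl) = 1-‿∈[0,1] (⟦⟧-∈[0,1] f fa)
  ⟦⟧-∈[0,1] (max' f g) (inj₁ fr , _) = ⟦⟧-∈[0,1] f fr
  ⟦⟧-∈[0,1] (max' f g) (inj₂ gr , _) = ⟦⟧-∈[0,1] g gr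
  ⟦⟧-∈[0,1] (min' f g) (inj₁ fr , _) = ⟦⟧-∈[0,1] f fr
  ⟦⟧-∈[0,1] (min' f g) (inj₂ gr , _) = ⟦⟧-∈[0,1] g gr
  ⟦⟧-∈[0,1] (S x g) ((_ , _ , _ , gr) , _) = ⟦⟧-∈[0,1] g gr
  ⟦⟧-∈[0,1] (J x g) ((_ , _ , _ , gr) , _) = ⟦⟧-∈[0,1] g gr
  ⟦⟧-∈[0,1] (g ⋆ u) ((_ , _ , _ , _ , _ , ga , uc , refl) , _) =
    *-∈[0,1] (⟦⟧-∈[0,1] g ga) (⟦⟧-∈[0,1] u uc)
  ⟦⟧-∈[0,1] (φ -⋆ g) (r∈[0,1] , _) = r∈[0,1]

  ⟦⟧-functional : ∀ f {s h r r'} → ⟦ f ⟧ s h r → ⟦ f ⟧ s h r' → r ≡ r'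
  ⟦⟧-functional [ φ ] = ind-functional φ
  ⟦⟧-functional (guard b _ f g) (_ , _ , _ , _ , β₁ , β₁' , fa₁ , gc₁ , refl)
                                (_ , _ , _ , _ , β₂ , β₂' , fa₂ , gc₂ , refl) =
    cong₂ _+_ (cong₂ _*_ (ind-functional b β₁ β₂) (⟦⟧-functional f fa₁ fa₂))
              (cong₂ _*_ (ind-functional (¬' b) β₁' β₂') (⟦⟧-functional g gc₁ gc₂))
  ⟦⟧-functional (conv q _ _ f g) (_ , _ , fa₁ , gc₁ , refl) (_ , _ , fa₂ , gc₂ , refl) =
    cong₂ (λ a c → q * a + (1ℚ - q) * c) (⟦⟧-functional f fa₁ fa₂) (⟦⟧-functional g gc₁ gc₂)
  ⟦⟧-functional (f · g) (_ , _ , fa₁ , gc₁ , refl) (_ , _ , fa₂ , gc₂ , refl) =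
    cong₂ _*_ (⟦⟧-functional f fa₁ fa₂) (⟦⟧-functional g gc₁ gc₂)
  ⟦⟧-functional (1- f) (_ , fa₁ , refl) (_ , fa₂ , refl) =
    cong (λ a → 1ℚ - a) (⟦⟧-functional f fa₁ fa₂)
  ⟦⟧-functional (max' f g) = isMax-unique
  ⟦⟧-functional (min' f g) = isMin-unique
  ⟦⟧-functional (S x g) = isMax-unique
  ⟦⟧-functional (J x g) = isMin-unique
  ⟦⟧-functional (g ⋆ u) = isMax-unique
  ⟦⟧-functional (φ -⋆ g) = isInf01-unique

  ∈-values-++ : ∀ f g {s h r} → ⟦ f ⟧ s h r ⊎ ⟦ g ⟧ s h r → r ∈ values f ++ values g

  ⟦⟧-∈-values : ∀ f {s h r} → ⟦ f ⟧ s h r → r ∈ values f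
  ⟦⟧-∈-values [ φ ] ind = ind-∈-01 φ ind
  ⟦⟧-∈-values (guard b _ f g) (_ , _ , _ , _ , β , β' , fa , gc , refl) =
    ∈-cartesianProductWith⁺ _+_ (∈-cartesianProductWith⁺ _*_ (ind-∈-01 b β) (⟦⟧-∈-values f fa))
                                (∈-cartesianProductWith⁺ _*_ (ind-∈-01 (¬' b) β') (⟦⟧-∈-values g gc))
  ⟦⟧-∈-values (conv q _ _ f g) (_ , _ , fa , gc , refl) =
    ∈-cartesianProductWith⁺ _+_ (∈-map⁺ (q *_) (⟦⟧-∈-values f fa))
                                (∈-map⁺ ((1ℚ - q) *_) (⟦⟧-∈-values g gc))
  ⟦⟧-∈-values (f · g) (_ , _ , fa , gc , refl) =
    ∈-cartesianProductWith⁺ _*_ (⟦⟧-∈-values f fa) (⟦⟧-∈-values g gc)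
  ⟦⟧-∈-values (1- f) (_ , fa , refl) = ∈-map⁺ (λ a → 1ℚ - a) (⟦⟧-∈-values f fa)
  ⟦⟧-∈-values (max' f g) (fr⊎gr , _) = ∈-values-++ f g fr⊎gr
  ⟦⟧-∈-values (min' f g) (fr⊎gr , _) = ∈-values-++ f g fr⊎gr
  ⟦⟧-∈-values (S x g) ((_ , _ , _ , gr) , _) = ⟦⟧-∈-values g gr
  ⟦⟧-∈-values (J x g) ((_ , _ , _ , gr) , _) = ⟦⟧-∈-values g gr
  ⟦⟧-∈-values (g ⋆ u) ((_ , _ , _ , _ , _ , ga , uc , refl) , _) =
    ∈-cartesianProductWith⁺ _*_ (⟦⟧-∈-values g ga) (⟦⟧-∈-values u uc)
  ⟦⟧-∈-values (φ -⋆ g) inf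
    with r₀ , r₀∈values , inf₀ ← finite-isInf01 lem (values g)
                                   (λ (_ , _ , _ , _ , _ , gt) → ⟦⟧-∈-values g gt)
                                   (λ (_ , _ , _ , _ , _ , gt) → ⟦⟧-∈[0,1] g gt)
    = subst (_∈ values (φ -⋆ g)) (isInf01-unique inf₀ inf) r₀∈values

  ∈-values-++ f g (inj₁ fr) = ∈-++⁺ˡ (⟦⟧-∈-values f fr)
  ∈-values-++ f g (inj₂ gr) = ∈-++⁺ʳ (values f) (⟦⟧-∈-values g gr)

  ⟦⟧-total : ∀ f s h → ∃ (⟦ f ⟧ s h)
  ⟦⟧-total [ φ ] s h = ind-total φ s h
  ⟦⟧-total (guard b _ f g) s h =
    let β , ind = ind-total b s h ; β' , ind' = ind-total (¬' b) s h
        a , fa = ⟦⟧-total f s h ; c , gc = ⟦⟧-total g s h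
    in β * a + β' * c , β , β' , a , c , ind , ind' , fa , gc , refl
  ⟦⟧-total (conv q _ _ f g) s h =
    let a , fa = ⟦⟧-total f s h ; c , gc = ⟦⟧-total g s h
    in q * a + (1ℚ - q) * c , a , c , fa , gc , refl
  ⟦⟧-total (f · g) s h =
    let a , fa = ⟦⟧-total f s h ; c , gc = ⟦⟧-total g s h in a * c , a , c , fa , gc , refl
  ⟦⟧-total (1- f) s h = let a , fa = ⟦⟧-total f s h in 1ℚ - a , a , fa , refl
  ⟦⟧-total (max' f g) s h = finite-isMax lem _ (∈-values-++ f g) (inj₁ (proj₂ (⟦⟧-total f s h)))
  ⟦⟧-total (min' f g) s h = finite-isMin lem _ (∈-values-++ f g) (inj₁ (proj₂ (⟦⟧-total f s h)))
  ⟦⟧-total (S x g) s h =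
    finite-isMax lem _ (λ (_ , _ , _ , gt) → ⟦⟧-∈-values g gt)
                       (s x , s , upd-self s x , proj₂ (⟦⟧-total g s h))
  ⟦⟧-total (J x g) s h =
    finite-isMin lem _ (λ (_ , _ , _ , gt) → ⟦⟧-∈-values g gt)
                       (s x , s , upd-self s x , proj₂ (⟦⟧-total g s h))
  ⟦⟧-total (g ⋆ u) s h =
    let a , gha = ⟦⟧-total g s h ; c , u∅c = ⟦⟧-total u s ∅
    in finite-isMax lem _ (λ (_ , _ , _ , _ , _ , ga , uc , t≡ac) →
                             subst (_∈ values (g ⋆ u)) (sym t≡ac)
                                   (∈-cartesianProductWith⁺ _*_ (⟦⟧-∈-values g ga) (⟦⟧-∈-values u uc)))
                          (h , ∅ , h≡h⋆∅ h , a , c , gha , u∅c , refl)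
  ⟦⟧-total (φ -⋆ g) s h =
    let r , _ , inf = finite-isInf01 lem (values g) (λ (_ , _ , _ , _ , _ , gt) → ⟦⟧-∈-values g gt)
                                                    (λ (_ , _ , _ , _ , _ , gt) → ⟦⟧-∈[0,1] g gt)
    in r , inf

mainTheorem1 : (k : ℕ) → 1 ≤ k → (Var Val Loc : Set) → (ι : Loc → Val) → (ι-inj : Injective _≡_ _≡_ ι) →
    (Atom : Set) → (interp : Atom → Model.Stack k Var Val Loc ι ι-inj → Model.Heap k Var Val Loc ι ι-inj → Set) →
    LEM →
    let open Model k Var Val Loc ι ι-inj in
    let open Logic Atom interp in
    (f : QSL) (s : Stack) (h : Heap) →
      (Σ ℚ λ r → ⟦ f ⟧ s h r × 0ℚ ≤ℚ r × r ≤ℚ 1ℚ)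
      × (∀ r r' → ⟦ f ⟧ s h r → ⟦ f ⟧ s h r' → r ≡ r')
mainTheorem1 k _ Var Val Loc ι ι-inj Atom interp lem f s h =
  let r , fr = ⟦⟧-total f s h in (r , fr , ⟦⟧-∈[0,1] f fr) , λ _ _ → ⟦⟧-functional f
  where open Semantics k Var Val Loc ι ι-inj Atom interp lem
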